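{- Let $k$ be a nonnegative integer. Then $${\rm ord}_2(t^e_{4k+2})={\rm ord}_2(t^o_{4k+2})={\rm ord}_2(t^e_{4k+3})={\rm ord}_2(t^o_{4k+3})=k.$$
   Context: An involution of $[n]$ is a permutation $\pi$ with $\pi^2=1$; it is even (resp. odd) if its number of 2-cycles is even (resp. odd). $t^e_n$ and $t^o_n$ are the numbers of even and odd involutions of $[n]$. ${\rm ord}_2(m)$ is the largest integer $e$ with $2^e\mid m$. -}

module Defs where

open import Data.Nat using (ℕ; zero; suc; _+_; _*_; _^_; _<_; _<?_)
open import Data.Nat.Divisibility using (_∣_; _∣?_)
open import Data.Fin using (Fin; toℕ)
open import Data.Fin.Properties using (_≟_)
open import Data.Vec using (Vec; []; _∷_; lookup)
open import Data.List using (List; []; _∷_; length; filter; map; concatMap; allFin)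
open import Data.List.Relation.Unary.All using (All; all?)
open import Data.Product using (_×_)
open import Relation.Nullary using (¬_; Dec)
open import Relation.Nullary.Decidable using (¬?)
open import Relation.Binary.PropositionalEquality using (_≡_)

allMaps : (m n : ℕ) → List (Vec (Fin n) m)
allMaps zero    n = [] ∷ []
allMaps (suc m) n = concatMap (λ x → map (x ∷_) (allMaps m n)) (allFin n)

-- π is an involution: π (π i) = i for all i (such a map is automatically a permutation).
IsInvolution : ∀ {n} → Vec (Fin n) n → Set
IsInvolution {n} π = All (λ i → lookup π (lookup π i) ≡ i) (allFin n)

isInvolution? : ∀ {n} (π : Vec (Fin n) n) → Dec (IsInvolution π)
isInvolution? {n} π = all? (λ i → lookup π (lookup π i) ≟ i) (allFin n)

involutions : (n : ℕ) → List (Vec (Fin n) n)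
involutions n = filter isInvolution? (allMaps n n)

twoCycles : ∀ {n} → Vec (Fin n) n → ℕ
twoCycles {n} π = length (filter (λ i → toℕ i <? toℕ (lookup π i)) (allFin n))

-- An involution is even iff its number of 2-cycles is even.
IsEvenPerm : ∀ {n} → Vec (Fin n) n → Set
IsEvenPerm π = 2 ∣ twoCycles π

isEvenPerm? : ∀ {n} (π : Vec (Fin n) n) → Dec (IsEvenPerm π)
isEvenPerm? π = 2 ∣? twoCycles π

tᵉ : ℕ → ℕ
tᵉ n = length (filter isEvenPerm? (involutions n))

tᵒ : ℕ → ℕ
tᵒ n = length (filter (λ π → ¬? (isEvenPerm? π)) (involutions n))

Ord₂ : ℕ → ℕ → Set
Ord₂ m e = (2 ^ e ∣ m) × ¬ (2 ^ suc e ∣ m)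

-- An involution of [n + 2] either fixes 0, and is then an involution of the other n + 1 points
-- with the same 2-cycles, or exchanges 0 with one of the n + 1 other points, and is then an
-- involution of the remaining n points with one 2-cycle fewer. Hence
--   tᵉ(n+2) = tᵉ(n+1) + (n+1) tᵒ(n)  and  tᵒ(n+2) = tᵒ(n+1) + (n+1) tᵉ(n),
-- so the total t = tᵉ + tᵒ and the signed count d = tᵉ − tᵒ satisfy
--   t(n+2) = t(n+1) + (n+1) t(n)  and  d(n+2) = d(n+1) − (n+1) d(n),  with t, d = 1, 1, … .
-- Following each recurrence through four steps shows by induction on k that t(4k) = 2ᵏ·odd with
-- t(4k+1) ≡ t(4k) + 8k·2ᵏ (mod 16·2ᵏ), and d(4k) = 2ᵏ·odd with d(4k+1) ≡ d(4k) + 4k·2ᵏ (mod 8·2ᵏ).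
-- The intermediate steps give t(4k+2) = 2ᵏ⁺¹·odd, 2ᵏ⁺³ ∣ d(4k+2), t(4k+3) = 2ᵏ⁺²·odd and
-- d(4k+3) = 2ᵏ⁺¹·odd, so both tᵉ = (t + d)/2 and tᵒ = (t − d)/2 are 2ᵏ·odd at 4k+2 and at 4k+3.

module Submission where

open import Defs
open import Data.Product using (_×_; _,_; proj₁; proj₂)
open import Relation.Binary.PropositionalEquality

module Recurrence where

  open import Data.Nat using (ℕ; zero; suc; _+_; _*_; _<?_; _<_)
  import Data.Nat.Properties as ℕP
  open import Data.Nat.Divisibility using (_∣?_; ∣m+n∣m⇒∣n; ∣m∣n⇒∣m+n; ∣-refl)
  open import Data.Bool using (Bool; true; false; _∧_; not)
  open import Data.Bool.Properties using (¬-not; not-involutive; ∧-conicalˡ)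
  open import Data.Fin using (Fin; toℕ; punchIn) renaming (zero to fzero; suc to fsuc)
  import Data.Fin.Properties as FinP
  open import Data.Vec using (Vec; _∷_; lookup; insertAt)
  import Data.Vec as Vec
  import Data.Vec.Properties as VecP
  open import Data.List using (List; []; _∷_; _++_; length; filter; map; concatMap; tabulate; allFin)
  open import Data.List.Relation.Unary.All.Properties using (tabulate⁺; tabulate⁻)
  open import Algebra.Properties.CommutativeMonoid.Sum ℕP.+-0-commutativeMonoid
    using (sum-syntax; sum-cong-≗; sum-remove; ∑-comm; sum-replicate-zero)
  open import Function using (_∘_; id; mk⇔)
  open import Relation.Nullary using (Dec; yes; no; does; contradiction)
  open import Relation.Nullary.Decidable using (does-⇔)
  open ≡-Reasoning

  indicator : Bool → ℕ
  indicator true  = 1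
  indicator false = 0

  count : ∀ {a} {A : Set a} → (A → Bool) → List A → ℕ
  count p []       = 0
  count p (x ∷ xs) = indicator (p x) + count p xs

  module _ {a} {A : Set a} where

    count-++ : ∀ (p : A → Bool) xs ys → count p (xs ++ ys) ≡ count p xs + count p ys
    count-++ p []       ys = refl
    count-++ p (x ∷ xs) ys =
      trans (cong (indicator (p x) +_) (count-++ p xs ys)) (sym (ℕP.+-assoc (indicator (p x)) _ _))

    count-cong : ∀ {p q : A → Bool} → p ≗ q → count p ≗ count q
    count-cong p≗q []       = refl
    count-cong p≗q (x ∷ xs) = cong₂ _+_ (cong indicator (p≗q x)) (count-cong p≗q xs)

    count-none : ∀ {p : A → Bool} → (∀ x → p x ≡ false) → ∀ xs → count p xs ≡ 0
    count-none none []       = refl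
    count-none none (x ∷ xs) rewrite none x = count-none none xs

    count-map : ∀ {b} {B : Set b} (p : A → Bool) (f : B → A) xs → count p (map f xs) ≡ count (p ∘ f) xs
    count-map p f []       = refl
    count-map p f (x ∷ xs) = cong (indicator (p (f x)) +_) (count-map p f xs)

    length-filter≡count : ∀ {ℓ} {P : A → Set ℓ} (P? : ∀ x → Dec (P x)) xs →
                          length (filter P? xs) ≡ count (does ∘ P?) xs
    length-filter≡count P? []       = refl
    length-filter≡count P? (x ∷ xs) with does (P? x)
    ... | true  = cong suc (length-filter≡count P? xs)
    ... | false = length-filter≡count P? xs

    length-filter²≡count : ∀ {ℓ ℓ′} {P : A → Set ℓ} {Q : A → Set ℓ′}
                           (P? : ∀ x → Dec (P x)) (Q? : ∀ x → Dec (Q x)) xs →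
                           length (filter Q? (filter P? xs)) ≡ count (λ x → does (P? x) ∧ does (Q? x)) xs
    length-filter²≡count P? Q? []       = refl
    length-filter²≡count P? Q? (x ∷ xs) with does (P? x)
    ... | false = length-filter²≡count P? Q? xs
    ... | true with does (Q? x)
    ...   | true  = cong suc (length-filter²≡count P? Q? xs)
    ...   | false = length-filter²≡count P? Q? xs

    count-tabulate : ∀ {n} (p : A → Bool) (f : Fin n → A) →
                     count p (tabulate f) ≡ ∑[ i < n ] indicator (p (f i))
    count-tabulate {zero}  p f = refl
    count-tabulate {suc n} p f = cong (indicator (p (f fzero)) +_) (count-tabulate p (f ∘ fsuc))

    count-concatMap-tabulate : ∀ {b} {B : Set b} {n} (p : A → Bool) (g : B → List A) (f : Fin n → B) →
                               count p (concatMap g (tabulate f)) ≡ ∑[ i < n ] count p (g (f i))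
    count-concatMap-tabulate {n = zero}  p g f = refl
    count-concatMap-tabulate {n = suc n} p g f =
      trans (count-++ p (g (f fzero)) _)
            (cong (count p (g (f fzero)) +_) (count-concatMap-tabulate p g (f ∘ fsuc)))

  sum-const : ∀ n c → ∑[ i < n ] c ≡ n * c
  sum-const zero    c = refl
  sum-const (suc n) c = cong (c +_) (sum-const n c)

  count-allMaps-suc : ∀ m N (p : Vec (Fin N) (suc m) → Bool) →
                      count p (allMaps (suc m) N) ≡ ∑[ x < N ] count (p ∘ (x ∷_)) (allMaps m N)
  count-allMaps-suc m N p =
    trans (count-concatMap-tabulate p (λ x → map (x ∷_) (allMaps m N)) id)
          (sum-cong-≗ (λ x → count-map p (x ∷_) (allMaps m N)))

  count-allMaps-insertAt : ∀ m N (j : Fin (suc m)) (p : Vec (Fin N) (suc m) → Bool) →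
                           count p (allMaps (suc m) N) ≡ ∑[ x < N ] count (λ v → p (insertAt v j x)) (allMaps m N)
  count-allMaps-insertAt m       N fzero    p = count-allMaps-suc m N p
  count-allMaps-insertAt (suc m) N (fsuc j) p = begin
    count p (allMaps (2 + m) N)
      ≡⟨ count-allMaps-suc (suc m) N p ⟩
    ∑[ x < N ] count (p ∘ (x ∷_)) (allMaps (suc m) N)
      ≡⟨ sum-cong-≗ (λ x → count-allMaps-insertAt m N j (p ∘ (x ∷_))) ⟩
    ∑[ x < N ] ∑[ z < N ] count (inserted x z) (allMaps m N)
      ≡⟨ ∑-comm (λ x z → count (inserted x z) (allMaps m N)) ⟩
    ∑[ z < N ] ∑[ x < N ] count (inserted x z) (allMaps m N)
      ≡⟨ sum-cong-≗ (λ z → count-allMaps-suc m N (λ v → p (insertAt v (fsuc j) z))) ⟨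
    ∑[ z < N ] count (λ v → p (insertAt v (fsuc j) z)) (allMaps (suc m) N)
      ∎
    where
    inserted : Fin N → Fin N → Vec (Fin N) m → Bool
    inserted x z v = p (x ∷ insertAt v j z)

  count-allMaps-avoiding : ∀ m N (y : Fin (suc N)) (p : Vec (Fin (suc N)) m → Bool) →
                           (∀ v → p v ≡ true → ∀ i → lookup v i ≢ y) →
                           count p (allMaps m (suc N)) ≡ count (p ∘ Vec.map (punchIn y)) (allMaps m N)
  count-allMaps-avoiding zero    N y p avoids = refl
  count-allMaps-avoiding (suc m) N y p avoids = begin
    count p (allMaps (suc m) (suc N))                                   ≡⟨ count-allMaps-suc m (suc N) p ⟩
    ∑[ x < suc N ] headed x                                             ≡⟨ sum-remove {i = y} headed ⟩
    headed y + ∑[ x < N ] headed (punchIn y x)                          ≡⟨ cong₂ _+_ headed-y≡0 (sum-cong-≗ headed-punchIn) ⟩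
    ∑[ x < N ] count (p ∘ Vec.map (punchIn y) ∘ (x ∷_)) (allMaps m N)   ≡⟨ count-allMaps-suc m N _ ⟨
    count (p ∘ Vec.map (punchIn y)) (allMaps (suc m) N)                 ∎
    where
    headed : Fin (suc N) → ℕ
    headed x = count (p ∘ (x ∷_)) (allMaps m (suc N))
    headed-y≡0 : headed y ≡ 0
    headed-y≡0 = count-none (λ v → ¬-not (λ pv → avoids (y ∷ v) pv fzero refl)) (allMaps m (suc N))
    headed-punchIn : ∀ x → headed (punchIn y x) ≡ count (p ∘ Vec.map (punchIn y) ∘ (x ∷_)) (allMaps m N)
    headed-punchIn x = count-allMaps-avoiding m N y (p ∘ (punchIn y x ∷_)) (λ v pv i → avoids _ pv (fsuc i))

  Involutive : ∀ {n} → Vec (Fin n) n → Set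
  Involutive {n} π = ∀ i → lookup π (lookup π i) ≡ i

  isInvolution?-true⇒involutive : ∀ {n} (π : Vec (Fin n) n) → does (isInvolution? π) ≡ true → Involutive π
  isInvolution?-true⇒involutive π isInv with isInvolution? π
  ... | yes inv = tabulate⁻ inv
  ... | no  _   = contradiction isInv λ ()

  isInvolution?-cong : ∀ {m n} (π : Vec (Fin m) m) (ρ : Vec (Fin n) n) →
                       (Involutive π → Involutive ρ) → (Involutive ρ → Involutive π) →
                       does (isInvolution? π) ≡ does (isInvolution? ρ)
  isInvolution?-cong π ρ to from =
    does-⇔ (mk⇔ (λ inv → tabulate⁺ (to (tabulate⁻ inv))) (λ inv → tabulate⁺ (from (tabulate⁻ inv))))
           (isInvolution? π) (isInvolution? ρ)

  ascent : ∀ {n} → Fin n → Fin n → Bool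
  ascent i j = does (toℕ i <? toℕ j)

  twoCycles≡sum : ∀ {n} (π : Vec (Fin n) n) → twoCycles π ≡ ∑[ i < n ] indicator (ascent i (lookup π i))
  twoCycles≡sum {n} π =
    trans (length-filter≡count (λ i → toℕ i <? toℕ (lookup π i)) (allFin n))
          (count-tabulate (λ i → ascent i (lookup π i)) id)

  ascent-punchIn : ∀ {n} (y : Fin (suc n)) (i j : Fin n) → ascent (punchIn y i) (punchIn y j) ≡ ascent i j
  ascent-punchIn y i j = does-⇔ (mk⇔ cancel mono) (toℕ (punchIn y i) <? toℕ (punchIn y j)) (toℕ i <? toℕ j)
    where
    cancel : toℕ (punchIn y i) < toℕ (punchIn y j) → toℕ i < toℕ j
    cancel lt = ℕP.≰⇒> (λ j≤i → ℕP.<⇒≱ lt (FinP.punchIn-mono-≤ y j i j≤i))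
    mono : toℕ i < toℕ j → toℕ (punchIn y i) < toℕ (punchIn y j)
    mono lt = ℕP.≰⇒> (λ j′≤i′ → ℕP.<⇒≱ lt (FinP.punchIn-cancel-≤ y j i j′≤i′))

  even?-suc : ∀ c → does (2 ∣? suc c) ≡ not (does (2 ∣? c))
  even?-suc zero    = refl
  even?-suc (suc c) = begin
    does (2 ∣? (2 + c))
      ≡⟨ does-⇔ (mk⇔ (λ 2∣2+c → ∣m+n∣m⇒∣n 2∣2+c ∣-refl) (∣m∣n⇒∣m+n ∣-refl)) (2 ∣? (2 + c)) (2 ∣? c) ⟩
    does (2 ∣? c)             ≡⟨ not-involutive _ ⟨
    not (not (does (2 ∣? c))) ≡⟨ cong not (even?-suc c) ⟨
    not (does (2 ∣? suc c))   ∎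

  _≡ᵇ_ : Bool → Bool → Bool
  x ≡ᵇ true  = x
  x ≡ᵇ false = not x

  not-≡ᵇ : ∀ x b → not x ≡ᵇ b ≡ x ≡ᵇ not b
  not-≡ᵇ x true  = refl
  not-≡ᵇ x false = not-involutive x

  isInvolutionWithEvenness : Bool → ∀ {n} → Vec (Fin n) n → Bool
  isInvolutionWithEvenness b π = does (isInvolution? π) ∧ (does (isEvenPerm? π) ≡ᵇ b)

  involutionCount : Bool → ℕ → ℕ
  involutionCount b n = count (isInvolutionWithEvenness b) (allMaps n n)

  tᵉ≡involutionCount : ∀ n → tᵉ n ≡ involutionCount true n
  tᵉ≡involutionCount n = length-filter²≡count isInvolution? isEvenPerm? (allMaps n n)

  tᵒ≡involutionCount : ∀ n → tᵒ n ≡ involutionCount false n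
  tᵒ≡involutionCount n = length-filter²≡count isInvolution? _ (allMaps n n)

  involution-lookup-sym : ∀ b {n} (π : Vec (Fin n) n) {i j} →
                          isInvolutionWithEvenness b π ≡ true → lookup π i ≡ j → lookup π j ≡ i
  involution-lookup-sym b π holds refl = isInvolution?-true⇒involutive π (∧-conicalˡ _ _ holds) _

  fixingZero : ∀ {n} → Vec (Fin n) n → Vec (Fin (suc n)) (suc n)
  fixingZero w = fzero ∷ Vec.map fsuc w

  -- The involution exchanging 0 and j + 1 and sending 1 + punchIn j i to 1 + punchIn j (w i).
  transposingZero : ∀ {n} → Fin (suc n) → Vec (Fin n) n → Vec (Fin (2 + n)) (2 + n)
  transposingZero j w = fsuc j ∷ insertAt (Vec.map fsuc (Vec.map (punchIn j) w)) j fzero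

  module _ {n} (w : Vec (Fin n) n) where

    private
      π = fixingZero w

      lookup-suc : ∀ i → lookup π (fsuc i) ≡ fsuc (lookup w i)
      lookup-suc i = VecP.lookup-map i fsuc w

      involutive⁻ : Involutive π → Involutive w
      involutive⁻ inv i = FinP.suc-injective (begin
        fsuc (lookup w (lookup w i))  ≡⟨ lookup-suc (lookup w i) ⟨
        lookup π (fsuc (lookup w i))  ≡⟨ cong (lookup π) (lookup-suc i) ⟨
        lookup π (lookup π (fsuc i))  ≡⟨ inv (fsuc i) ⟩
        fsuc i                        ∎)

      involutive⁺ : Involutive w → Involutive π
      involutive⁺ inv fzero    = refl
      involutive⁺ inv (fsuc i) = begin
        lookup π (lookup π (fsuc i))  ≡⟨ cong (lookup π) (lookup-suc i) ⟩
        lookup π (fsuc (lookup w i))  ≡⟨ lookup-suc (lookup w i) ⟩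
        fsuc (lookup w (lookup w i))  ≡⟨ cong fsuc (inv i) ⟩
        fsuc i                        ∎

      twoCycles-fixingZero : twoCycles π ≡ twoCycles w
      twoCycles-fixingZero = begin
        twoCycles π                                   ≡⟨ twoCycles≡sum π ⟩
        ∑[ i < n ] indicator (ascent (fsuc i) (lookup π (fsuc i)))
          ≡⟨ sum-cong-≗ (λ i → cong (indicator ∘ ascent (fsuc i)) (lookup-suc i)) ⟩
        ∑[ i < n ] indicator (ascent i (lookup w i))  ≡⟨ twoCycles≡sum w ⟨
        twoCycles w                                   ∎

    isInvolutionWithEvenness-fixingZero : ∀ b →
      isInvolutionWithEvenness b (fixingZero w) ≡ isInvolutionWithEvenness b w
    isInvolutionWithEvenness-fixingZero b =
      cong₂ _∧_ (isInvolution?-cong π w involutive⁻ involutive⁺)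
                (cong (λ c → does (2 ∣? c) ≡ᵇ b) twoCycles-fixingZero)

  module _ {n} (j : Fin (suc n)) (w : Vec (Fin n) n) where

    private
      π = transposingZero j w

      lookup-j : lookup π (fsuc j) ≡ fzero
      lookup-j = VecP.insertAt-lookup _ j fzero

      lookup-punchIn : ∀ i → lookup π (fsuc (punchIn j i)) ≡ fsuc (punchIn j (lookup w i))
      lookup-punchIn i = begin
        lookup π (fsuc (punchIn j i))                     ≡⟨ VecP.insertAt-punchIn (Vec.map fsuc w′) j fzero i ⟩
        lookup (Vec.map fsuc w′) i                        ≡⟨ VecP.lookup-map i fsuc w′ ⟩
        fsuc (lookup w′ i)                                ≡⟨ cong fsuc (VecP.lookup-map i (punchIn j) w) ⟩
        fsuc (punchIn j (lookup w i))                     ∎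
        where w′ = Vec.map (punchIn j) w

      involutive⁻ : Involutive π → Involutive w
      involutive⁻ inv i = FinP.punchIn-injective j _ _ (FinP.suc-injective (begin
        fsuc (punchIn j (lookup w (lookup w i)))   ≡⟨ lookup-punchIn (lookup w i) ⟨
        lookup π (fsuc (punchIn j (lookup w i)))   ≡⟨ cong (lookup π) (lookup-punchIn i) ⟨
        lookup π (lookup π (fsuc (punchIn j i)))   ≡⟨ inv (fsuc (punchIn j i)) ⟩
        fsuc (punchIn j i)                         ∎))

      involutive⁺ : Involutive w → Involutive π
      involutive⁺ inv fzero = lookup-j
      involutive⁺ inv (fsuc q) with j FinP.≟ q
      ... | yes refl = cong (lookup π) lookup-j
      ... | no  j≢q  =
        subst (λ q → lookup π (lookup π (fsuc q)) ≡ fsuc q) (FinP.punchIn-punchOut j≢q) (on-punchIn _)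
        where
        on-punchIn : ∀ i → lookup π (lookup π (fsuc (punchIn j i))) ≡ fsuc (punchIn j i)
        on-punchIn i = begin
          lookup π (lookup π (fsuc (punchIn j i)))   ≡⟨ cong (lookup π) (lookup-punchIn i) ⟩
          lookup π (fsuc (punchIn j (lookup w i)))   ≡⟨ lookup-punchIn (lookup w i) ⟩
          fsuc (punchIn j (lookup w (lookup w i)))   ≡⟨ cong (fsuc ∘ punchIn j) (inv i) ⟩
          fsuc (punchIn j i)                         ∎

      twoCycles-transposingZero : twoCycles π ≡ suc (twoCycles w)
      twoCycles-transposingZero = begin
        twoCycles π                                            ≡⟨ twoCycles≡sum π ⟩
        1 + ∑[ q < suc n ] ascentAt q                          ≡⟨ cong suc (sum-remove {i = j} ascentAt) ⟩
        1 + (ascentAt j + ∑[ i < n ] ascentAt (punchIn j i))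
          ≡⟨ cong (λ a → 1 + (indicator (ascent (fsuc j) a) + ∑[ i < n ] ascentAt (punchIn j i))) lookup-j ⟩
        1 + ∑[ i < n ] ascentAt (punchIn j i)                  ≡⟨ cong suc (sum-cong-≗ ascentAt-punchIn) ⟩
        1 + ∑[ i < n ] indicator (ascent i (lookup w i))       ≡⟨ cong suc (twoCycles≡sum w) ⟨
        suc (twoCycles w)                                      ∎
        where
        ascentAt : Fin (suc n) → ℕ
        ascentAt q = indicator (ascent (fsuc q) (lookup π (fsuc q)))
        ascentAt-punchIn : ∀ i → ascentAt (punchIn j i) ≡ indicator (ascent i (lookup w i))
        ascentAt-punchIn i = cong indicator (trans (cong (ascent (fsuc (punchIn j i))) (lookup-punchIn i))
                                                   (ascent-punchIn j i (lookup w i)))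

    isInvolutionWithEvenness-transposingZero : ∀ b →
      isInvolutionWithEvenness b (transposingZero j w) ≡ isInvolutionWithEvenness (not b) w
    isInvolutionWithEvenness-transposingZero b =
      cong₂ _∧_ (isInvolution?-cong π w involutive⁻ involutive⁺) (begin
        does (2 ∣? twoCycles π) ≡ᵇ b          ≡⟨ cong (λ c → does (2 ∣? c) ≡ᵇ b) twoCycles-transposingZero ⟩
        does (2 ∣? suc (twoCycles w)) ≡ᵇ b    ≡⟨ cong (_≡ᵇ b) (even?-suc (twoCycles w)) ⟩
        not (does (2 ∣? twoCycles w)) ≡ᵇ b    ≡⟨ not-≡ᵇ _ b ⟩
        does (2 ∣? twoCycles w) ≡ᵇ not b      ∎)

  count-fixingZero : ∀ b n →
    count (isInvolutionWithEvenness b ∘ (fzero ∷_)) (allMaps n (suc n)) ≡ involutionCount b n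
  count-fixingZero b n =
    trans (count-allMaps-avoiding n n fzero _ avoids-zero)
          (count-cong (λ w → isInvolutionWithEvenness-fixingZero w b) (allMaps n n))
    where
    avoids-zero : ∀ v → isInvolutionWithEvenness b (fzero ∷ v) ≡ true → ∀ i → lookup v i ≢ fzero
    avoids-zero v holds i vᵢ≡0 =
      contradiction (involution-lookup-sym b (fzero ∷ v) {i = fsuc i} holds vᵢ≡0) λ ()

  count-transposingZero : ∀ b n (j : Fin (suc n)) →
    count (isInvolutionWithEvenness b ∘ (fsuc j ∷_)) (allMaps (suc n) (2 + n)) ≡ involutionCount (not b) n
  count-transposingZero b n j = begin
    count (isInvolutionWithEvenness b ∘ (fsuc j ∷_)) (allMaps (suc n) (2 + n))
      ≡⟨ count-allMaps-insertAt n (2 + n) j _ ⟩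
    count (paired fzero) (allMaps n (2 + n)) + ∑[ x < suc n ] count (paired (fsuc x)) (allMaps n (2 + n))
      ≡⟨ cong (count (paired fzero) (allMaps n (2 + n)) +_) (trans (sum-cong-≗ unpaired) (sum-replicate-zero (suc n))) ⟩
    count (paired fzero) (allMaps n (2 + n)) + 0
      ≡⟨ ℕP.+-identityʳ _ ⟩
    count (paired fzero) (allMaps n (2 + n))
      ≡⟨ count-allMaps-avoiding n (suc n) fzero _ avoids-zero ⟩
    count (paired fzero ∘ Vec.map fsuc) (allMaps n (suc n))
      ≡⟨ count-allMaps-avoiding n n j _ avoids-j ⟩
    count (isInvolutionWithEvenness b ∘ transposingZero j) (allMaps n n)
      ≡⟨ count-cong (λ w → isInvolutionWithEvenness-transposingZero j w b) (allMaps n n) ⟩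
    involutionCount (not b) n
      ∎
    where
    -- the predicate on the map 0 ↦ j + 1, j + 1 ↦ x, with the other values read from v
    paired : Fin (2 + n) → Vec (Fin (2 + n)) n → Bool
    paired x v = isInvolutionWithEvenness b (fsuc j ∷ insertAt v j x)

    unpaired : ∀ x → count (paired (fsuc x)) (allMaps n (2 + n)) ≡ 0
    unpaired x = count-none (λ v → ¬-not λ holds → contradiction
      (trans (sym (VecP.insertAt-lookup v j (fsuc x)))
             (involution-lookup-sym b (fsuc j ∷ insertAt v j (fsuc x)) {i = fzero} holds refl)) λ ())
      (allMaps n (2 + n))

    avoids-zero : ∀ v → paired fzero v ≡ true → ∀ i → lookup v i ≢ fzero
    avoids-zero v holds i vᵢ≡0 = FinP.punchInᵢ≢i j i (sym (FinP.suc-injective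
      (involution-lookup-sym b (fsuc j ∷ insertAt v j fzero) {i = fsuc (punchIn j i)} holds
         (trans (VecP.insertAt-punchIn v j fzero i) vᵢ≡0))))

    avoids-j : ∀ w → paired fzero (Vec.map fsuc w) ≡ true → ∀ i → lookup w i ≢ j
    avoids-j w holds i wᵢ≡j = contradiction
      (trans (sym (VecP.insertAt-lookup (Vec.map fsuc w) j fzero))
             (involution-lookup-sym b (fsuc j ∷ insertAt (Vec.map fsuc w) j fzero) {i = fsuc (punchIn j i)} holds
                (trans (VecP.insertAt-punchIn (Vec.map fsuc w) j fzero i)
                       (trans (VecP.lookup-map i fsuc w) (cong fsuc wᵢ≡j))))) λ ()

  involutionCount-rec : ∀ b n →
    involutionCount b (2 + n) ≡ involutionCount b (1 + n) + (1 + n) * involutionCount (not b) n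
  involutionCount-rec b n =
    trans (count-allMaps-suc (suc n) (2 + n) (isInvolutionWithEvenness b))
          (cong₂ _+_ (count-fixingZero b (suc n))
                     (trans (sum-cong-≗ (count-transposingZero b n)) (sum-const (suc n) _)))

  tᵉ-rec : ∀ n → tᵉ (2 + n) ≡ tᵉ (1 + n) + (1 + n) * tᵒ n
  tᵉ-rec n rewrite tᵉ≡involutionCount (2 + n) | tᵉ≡involutionCount (1 + n) | tᵒ≡involutionCount n =
    involutionCount-rec true n

  tᵒ-rec : ∀ n → tᵒ (2 + n) ≡ tᵒ (1 + n) + (1 + n) * tᵉ n
  tᵒ-rec n rewrite tᵒ≡involutionCount (2 + n) | tᵒ≡involutionCount (1 + n) | tᵉ≡involutionCount n =
    involutionCount-rec false n

module TwoAdic where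

  open import Data.Nat as ℕ using (ℕ; zero; suc)
  import Data.Nat.Properties as ℕP
  import Data.Nat.Divisibility as ℕ
  open import Data.Integer using (ℤ; +_; _+_; _*_; _-_; -_; _^_)
  import Data.Integer.Properties as ℤP
  open import Data.Integer.Divisibility.Signed
    using (_∣_; divides; ∣⇒∣ᵤ; ∣ᵤ⇒∣; *-cancelˡ-∣; ∣m+n∣m⇒∣n; ∣m⇒∣m*n; ∣m⇒∣-m; ∣-refl; ∣-trans)
  open import Data.Integer.Tactic.RingSolver using (solve; solve-∀)
  open import Data.List using (_∷_; [])
  open import Relation.Nullary using (¬_)
  open Recurrence using (tᵉ-rec; tᵒ-rec)

  record OddMultiple (y a : ℤ) : Set where
    constructor oddMultiple
    field
      m  : ℤ
      a≡ : a ≡ y * (+ 2 * m + + 1)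

  oddMultiple-neg : ∀ {X a} → OddMultiple X a → OddMultiple X (- a)
  oddMultiple-neg {X} (oddMultiple p refl) = oddMultiple (- p - + 1) (solve (X ∷ p ∷ []))

  oddMultiple⇒∣ : ∀ {X a} → OddMultiple X a → X ∣ a
  oddMultiple⇒∣ {X} (oddMultiple p refl) = divides (+ 2 * p + + 1) (ℤP.*-comm X _)

  halve : ∀ {X e a b} → + 2 * e ≡ a + b → OddMultiple (+ 2 * X) a → + 4 * X ∣ b → OddMultiple X e
  halve {X} {e} 2e≡a+b (oddMultiple p refl) (divides r refl) =
    oddMultiple (p + r) (ℤP.*-cancelˡ-≡ (+ 2) e _ (trans 2e≡a+b (solve (X ∷ p ∷ r ∷ []))))

  pos-^ : ∀ m n → + (m ℕ.^ n) ≡ (+ m) ^ n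
  pos-^ m zero    = refl
  pos-^ m (suc n) = trans (ℤP.pos-* m (m ℕ.^ n)) (cong (+ m *_) (pos-^ m n))

  two∤odd : ∀ c → ¬ (+ 2 ∣ + 2 * c + + 1)
  two∤odd c 2∣odd with ℕ.∣1⇒≡1 (∣⇒∣ᵤ (∣m+n∣m⇒∣n 2∣odd (∣m⇒∣m*n c ∣-refl)))
  ... | ()

  oddMultiple⇒Ord₂ : ∀ k {t} → OddMultiple ((+ 2) ^ k) (+ t) → Ord₂ t k
  oddMultiple⇒Ord₂ k {t} (oddMultiple c t≡) = 2^k∣t , 2^k+1∤t
    where
    instance _ = ℕP.m^n≢0 2 k
    t≡2^k*odd : + t ≡ + (2 ℕ.^ k) * (+ 2 * c + + 1)
    t≡2^k*odd = trans t≡ (cong (_* (+ 2 * c + + 1)) (sym (pos-^ 2 k)))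
    2^k∣t : 2 ℕ.^ k ℕ.∣ t
    2^k∣t = ∣⇒∣ᵤ (divides (+ 2 * c + + 1) (trans t≡2^k*odd (ℤP.*-comm (+ (2 ℕ.^ k)) _)))
    2^k+1∤t : ¬ (2 ℕ.^ suc k ℕ.∣ t)
    2^k+1∤t 2^k+1∣t = two∤odd c (*-cancelˡ-∣ (+ (2 ℕ.^ k))
      (subst₂ _∣_ (trans (ℤP.pos-* 2 (2 ℕ.^ k)) (ℤP.*-comm (+ 2) (+ (2 ℕ.^ k)))) t≡2^k*odd (∣ᵤ⇒∣ 2^k+1∣t)))

  record Shape⁺ (X K u₀ u₁ : ℤ) : Set where
    constructor shape⁺
    field
      α β : ℤ
      u₀≡ : u₀ ≡ X * (+ 2 * α + + 1)
      u₁≡ : u₁ ≡ u₀ + + 8 * X * (K + + 2 * β)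

  record Shape⁻ (X K u₀ u₁ : ℤ) : Set where
    constructor shape⁻
    field
      γ δ : ℤ
      u₀≡ : u₀ ≡ X * (+ 2 * γ + + 1)
      u₁≡ : u₁ ≡ u₀ + + 4 * X * (K + + 2 * δ)

  module _ {X K : ℤ} where

    shape⁺-step₂ : ∀ {u₀ u₁ u₂} → Shape⁺ X K u₀ u₁ → u₂ ≡ u₁ + (+ 4 * K + + 1) * u₀ →
                   OddMultiple (+ 2 * X) u₂
    shape⁺-step₂ (shape⁺ α β refl refl) refl =
      oddMultiple (α + + 2 * K * α + + 3 * K + + 4 * β) (solve (X ∷ K ∷ α ∷ β ∷ []))

    shape⁺-step₃ : ∀ {u₀ u₁ u₂ u₃} → Shape⁺ X K u₀ u₁ →
                   u₂ ≡ u₁ + (+ 4 * K + + 1) * u₀ → u₃ ≡ u₂ + (+ 4 * K + + 2) * u₁ →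
                   OddMultiple (+ 4 * X) u₃
    shape⁺-step₃ (shape⁺ α β refl refl) refl refl =
      oddMultiple (α + + 2 * K * α + + 4 * K + + 6 * β + + 4 * K * K + + 8 * K * β)
                  (solve (X ∷ K ∷ α ∷ β ∷ []))

    shape⁺-step₄ : ∀ {u₂ u₃ u₄ u₅} → OddMultiple (+ 2 * X) u₂ → OddMultiple (+ 4 * X) u₃ →
                   u₄ ≡ u₃ + (+ 4 * K + + 3) * u₂ → u₅ ≡ u₄ + (+ 4 * K + + 4) * u₃ →
                   Shape⁺ (+ 2 * X) (+ 1 + K) u₄ u₅
    shape⁺-step₄ (oddMultiple p refl) (oddMultiple q refl) refl refl =
      shape⁺ (+ 2 * q + + 4 * K * p + + 2 * K + + 3 * p + + 2) ((K + + 1) * q)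
             (solve (X ∷ K ∷ p ∷ q ∷ [])) (solve (X ∷ K ∷ p ∷ q ∷ []))

    shape⁻-step₂ : ∀ {u₀ u₁ u₂} → Shape⁻ X K u₀ u₁ → u₂ ≡ u₁ - (+ 4 * K + + 1) * u₀ →
                   + 8 * X ∣ u₂
    shape⁻-step₂ (shape⁻ γ δ refl refl) refl = divides (δ - K * γ) (solve (X ∷ K ∷ γ ∷ δ ∷ []))

    shape⁻-step₃ : ∀ {u₀ u₁ u₂ u₃} → Shape⁻ X K u₀ u₁ →
                   u₂ ≡ u₁ - (+ 4 * K + + 1) * u₀ → u₃ ≡ u₂ - (+ 4 * K + + 2) * u₁ →
                   OddMultiple (+ 2 * X) u₃
    shape⁻-step₃ (shape⁻ γ δ refl refl) refl refl =
      oddMultiple (- (+ 2 * δ + + 4 * K * γ + + 3 * K + + 4 * K * K + + 8 * K * δ + γ + + 1))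
                  (solve (X ∷ K ∷ γ ∷ δ ∷ []))

    shape⁻-step₄ : ∀ {u₂ u₃ u₄ u₅} → + 8 * X ∣ u₂ → OddMultiple (+ 2 * X) u₃ →
                   u₄ ≡ u₃ - (+ 4 * K + + 3) * u₂ → u₅ ≡ u₄ - (+ 4 * K + + 4) * u₃ →
                   Shape⁻ (+ 2 * X) (+ 1 + K) u₄ u₅
    shape⁻-step₄ (divides r refl) (oddMultiple c refl) refl refl =
      shape⁻ (c - + 2 * (+ 4 * K + + 3) * r) (- ((K + + 1) * (c + + 1)))
             (solve (X ∷ K ∷ r ∷ c ∷ [])) (solve (X ∷ K ∷ r ∷ c ∷ []))

  module _ (_∙_ : ℤ → ℤ → ℤ) (u : ℕ → ℤ)
           (u-rec : ∀ n → u (2 ℕ.+ n) ≡ u (1 ℕ.+ n) ∙ (+ (1 ℕ.+ n) * u n)) where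

    recurrence-mod4 : ∀ j k → let n = j ℕ.+ k ℕ.* 4 in
                      u (2 ℕ.+ n) ≡ u (1 ℕ.+ n) ∙ ((+ 4 * + k + + (1 ℕ.+ j)) * u n)
    recurrence-mod4 j k = trans (u-rec n) (cong (λ c → u (1 ℕ.+ n) ∙ (c * u n)) coefficient)
      where
      n = j ℕ.+ k ℕ.* 4
      coefficient : + (1 ℕ.+ n) ≡ + 4 * + k + + (1 ℕ.+ j)
      coefficient = begin
        + (1 ℕ.+ (j ℕ.+ k ℕ.* 4))   ≡⟨ cong +_ (ℕP.+-comm (1 ℕ.+ j) (k ℕ.* 4)) ⟩
        + (k ℕ.* 4 ℕ.+ (1 ℕ.+ j))   ≡⟨ ℤP.pos-+ (k ℕ.* 4) (1 ℕ.+ j) ⟩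
        + (k ℕ.* 4) + + (1 ℕ.+ j)   ≡⟨ cong (_+ + (1 ℕ.+ j)) (trans (ℤP.pos-* k 4) (ℤP.*-comm (+ k) (+ 4))) ⟩
        + 4 * + k + + (1 ℕ.+ j)     ∎
        where open ≡-Reasoning

  module _ (u : ℕ → ℤ) (u-rec : ∀ n → u (2 ℕ.+ n) ≡ u (1 ℕ.+ n) + + (1 ℕ.+ n) * u n)
           (u₀ : u 0 ≡ + 1) (u₁ : u 1 ≡ + 1) where

    shape⁺-at : ∀ k → Shape⁺ ((+ 2) ^ k) (+ k) (u (k ℕ.* 4)) (u (1 ℕ.+ k ℕ.* 4))
    twoAdic⁺  : ∀ k → OddMultiple (+ 2 * (+ 2) ^ k) (u (2 ℕ.+ k ℕ.* 4)) ×
                      OddMultiple (+ 4 * (+ 2) ^ k) (u (3 ℕ.+ k ℕ.* 4))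

    twoAdic⁺ k = shape⁺-step₂ (shape⁺-at k) (rec 0 k) , shape⁺-step₃ (shape⁺-at k) (rec 0 k) (rec 1 k)
      where rec = recurrence-mod4 _+_ u u-rec

    shape⁺-at zero    = shape⁺ (+ 0) (+ 0) u₀ (trans u₁ (cong (_+ + 0) (sym u₀)))
    shape⁺-at (suc k) = shape⁺-step₄ {K = + k} (proj₁ (twoAdic⁺ k)) (proj₂ (twoAdic⁺ k)) (rec 2 k) (rec 3 k)
      where rec = recurrence-mod4 _+_ u u-rec

  module _ (u : ℕ → ℤ) (u-rec : ∀ n → u (2 ℕ.+ n) ≡ u (1 ℕ.+ n) - + (1 ℕ.+ n) * u n)
           (u₀ : u 0 ≡ + 1) (u₁ : u 1 ≡ + 1) where

    shape⁻-at : ∀ k → Shape⁻ ((+ 2) ^ k) (+ k) (u (k ℕ.* 4)) (u (1 ℕ.+ k ℕ.* 4))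
    twoAdic⁻  : ∀ k → + 8 * (+ 2) ^ k ∣ u (2 ℕ.+ k ℕ.* 4) ×
                      OddMultiple (+ 2 * (+ 2) ^ k) (u (3 ℕ.+ k ℕ.* 4))

    twoAdic⁻ k = shape⁻-step₂ (shape⁻-at k) (rec 0 k) , shape⁻-step₃ (shape⁻-at k) (rec 0 k) (rec 1 k)
      where rec = recurrence-mod4 _-_ u u-rec

    shape⁻-at zero    = shape⁻ (+ 0) (+ 0) u₀ (trans u₁ (cong (_+ + 0) (sym u₀)))
    shape⁻-at (suc k) = shape⁻-step₄ {K = + k} (proj₁ (twoAdic⁻ k)) (proj₂ (twoAdic⁻ k)) (rec 2 k) (rec 3 k)
      where rec = recurrence-mod4 _-_ u u-rec

  tᵉℤ tᵒℤ total signed : ℕ → ℤ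
  tᵉℤ n = + tᵉ n
  tᵒℤ n = + tᵒ n
  total n = tᵉℤ n + tᵒℤ n
  signed n = tᵉℤ n - tᵒℤ n

  pos-recurrence : ∀ {a} b c d → a ≡ b ℕ.+ c ℕ.* d → + a ≡ + b + + c * + d
  pos-recurrence b c d refl = trans (ℤP.pos-+ b (c ℕ.* d)) (cong (_+_ (+ b)) (ℤP.pos-* c d))

  total-rec : ∀ n → total (2 ℕ.+ n) ≡ total (1 ℕ.+ n) + + (1 ℕ.+ n) * total n
  total-rec n =
    trans (cong₂ _+_ (pos-recurrence _ (1 ℕ.+ n) (tᵒ n) (tᵉ-rec n)) (pos-recurrence _ (1 ℕ.+ n) (tᵉ n) (tᵒ-rec n)))
          (regroup (tᵉℤ (1 ℕ.+ n)) (tᵒℤ (1 ℕ.+ n)) (tᵉℤ n) (tᵒℤ n) (+ (1 ℕ.+ n)))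
    where
    regroup : ∀ a b c d m → (a + m * d) + (b + m * c) ≡ (a + b) + m * (c + d)
    regroup = solve-∀

  signed-rec : ∀ n → signed (2 ℕ.+ n) ≡ signed (1 ℕ.+ n) - + (1 ℕ.+ n) * signed n
  signed-rec n =
    trans (cong₂ _-_ (pos-recurrence _ (1 ℕ.+ n) (tᵒ n) (tᵉ-rec n)) (pos-recurrence _ (1 ℕ.+ n) (tᵉ n) (tᵒ-rec n)))
          (regroup (tᵉℤ (1 ℕ.+ n)) (tᵒℤ (1 ℕ.+ n)) (tᵉℤ n) (tᵒℤ n) (+ (1 ℕ.+ n)))
    where
    regroup : ∀ a b c d m → (a + m * d) - (b + m * c) ≡ (a - b) - m * (c - d)
    regroup = solve-∀

  halves-oddSum : ∀ {X e o} → OddMultiple (+ 2 * X) (e + o) → + 8 * X ∣ e - o →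
                  OddMultiple X e × OddMultiple X o
  halves-oddSum {X} {e} {o} e+o e-o =
    halve (twice-e e o) e+o 4X∣e-o , halve (twice-o e o) e+o (∣m⇒∣-m 4X∣e-o)
    where
    8X≡2*4X : ∀ X → + 8 * X ≡ + 2 * (+ 4 * X)
    8X≡2*4X = solve-∀
    4X∣e-o : + 4 * X ∣ e - o
    4X∣e-o = ∣-trans (divides (+ 2) (8X≡2*4X X)) e-o
    twice-e : ∀ e o → + 2 * e ≡ (e + o) + (e - o)
    twice-e = solve-∀
    twice-o : ∀ e o → + 2 * o ≡ (e + o) + - (e - o)
    twice-o = solve-∀

  halves-oddDifference : ∀ {X e o} → OddMultiple (+ 4 * X) (e + o) → OddMultiple (+ 2 * X) (e - o) →
                         OddMultiple X e × OddMultiple X o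
  halves-oddDifference {X} {e} {o} e+o e-o =
    halve (twice-e e o) e-o (oddMultiple⇒∣ e+o) , halve (twice-o e o) (oddMultiple-neg e-o) (oddMultiple⇒∣ e+o)
    where
    twice-e : ∀ e o → + 2 * e ≡ (e - o) + (e + o)
    twice-e = solve-∀
    twice-o : ∀ e o → + 2 * o ≡ - (e - o) + (e + o)
    twice-o = solve-∀

  ord₂-involutionCounts : ∀ k → Ord₂ (tᵉ (2 ℕ.+ k ℕ.* 4)) k × Ord₂ (tᵒ (2 ℕ.+ k ℕ.* 4)) k ×
                                Ord₂ (tᵉ (3 ℕ.+ k ℕ.* 4)) k × Ord₂ (tᵒ (3 ℕ.+ k ℕ.* 4)) k
  ord₂-involutionCounts k =
    let (total₂ , total₃)   = twoAdic⁺ total total-rec refl refl k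
        (signed₂ , signed₃) = twoAdic⁻ signed signed-rec refl refl k
        (tᵉ₂ , tᵒ₂)         = halves-oddSum total₂ signed₂
        (tᵉ₃ , tᵒ₃)         = halves-oddDifference total₃ signed₃
    in oddMultiple⇒Ord₂ k tᵉ₂ , oddMultiple⇒Ord₂ k tᵒ₂ , oddMultiple⇒Ord₂ k tᵉ₃ , oddMultiple⇒Ord₂ k tᵒ₃

open import Data.Nat using (ℕ; _+_; _*_)
import Data.Nat.Properties as ℕP
open TwoAdic using (ord₂-involutionCounts)

corollary5p3 : (k : ℕ) →
    Ord₂ (tᵉ (4 * k + 2)) k × Ord₂ (tᵒ (4 * k + 2)) k ×
    Ord₂ (tᵉ (4 * k + 3)) k × Ord₂ (tᵒ (4 * k + 3)) k
corollary5p3 k =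
  let (tᵉ₂ , tᵒ₂ , tᵉ₃ , tᵒ₃) = ord₂-involutionCounts k
  in reindex {tᵉ} 2 tᵉ₂ , reindex {tᵒ} 2 tᵒ₂ , reindex {tᵉ} 3 tᵉ₃ , reindex {tᵒ} 3 tᵒ₃
  where
  reindex : ∀ {t : ℕ → ℕ} j → Ord₂ (t (j + k * 4)) k → Ord₂ (t (4 * k + j)) k
  reindex {t} j = subst (λ n → Ord₂ (t n) k) (trans (ℕP.+-comm j (k * 4)) (cong (_+ j) (ℕP.*-comm k 4)))
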